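{- Let $G=(V,E)$ be a strongly connected directed graph with positive edge weights, $\mu$ its shortest-path distance, $H$ a Contraction Hierarchy of $G$ and $\mathcal{T}$ the set of the $k$ highest-ranked nodes of $H$ (transit nodes), with $D_\mathcal{T}(a,b)=\mu(a,b)$ for $a,b\in\mathcal{T}$. For $s\in V$, let $R(s)\subseteq\mathcal{T}$ be the set of transit nodes settled by Dijkstra's algorithm from $s$ in the upward graph $H^\uparrow$ where edges leaving transit nodes are never relaxed, each $v\in R(s)$ with its tentative distance $\delta(v)$. Apply post-search-stalling: for all $t_1,t_2\in R(s)$ with $t_1\neq t_2$, if $\delta(t_1)+D_\mathcal{T}(t_1,t_2)\le \delta(t_2)$, discard $t_2$. Then every node remaining after post-search-stalling is the first transit node on some shortest path in $G$ starting at $s$.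
   Context: A Contraction Hierarchy (CH) of $G$ is given by a total order (rank) on $V$ and a set of shortcut edges, each shortcut $(u,w)$ having weight equal to the length of some $u$--$w$ path in $G$, such that in the graph $H$ consisting of the original edges plus shortcuts, for any $s,t\in V$ with an $s$--$t$ path there exists a shortest $s$--$t$ path in $H$ that is an up-down path (only edges to higher-ranked nodes up to its highest node, then only edges to lower-ranked nodes). $H^\uparrow$ denotes the graph with only the edges of $H$ leading to higher-ranked nodes.
   Formalization: The edge weights are positive rationals, so μ, $D_\mathcal{T}$ and the tentative distances δ take rational values. -}

module Defs where

open import Data.Nat using (ℕ; _∸_) renaming (_≤_ to _≤ℕ_)
open import Data.Fin using (Fin; toℕ) renaming (_<_ to _<ᶠ_)
open import Data.Rational using (ℚ; 0ℚ; _+_; _≤_; _<_)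
open import Data.List using (List; _++_)
open import Data.List.Membership.Propositional using (_∈_)
open import Data.List.Relation.Unary.All using (All)
open import Data.Product using (Σ; Σ-syntax; _×_)
open import Relation.Binary.PropositionalEquality using (_≡_; _≢_)
open import Relation.Nullary using (¬_)
open import Function.Definitions using (Injective)

record Edge (n : ℕ) : Set where
  constructor edge
  field
    src : Fin n
    tgt : Fin n
    wt  : ℚ
open Edge public

data Walk {n : ℕ} (E : List (Edge n)) : Fin n → Fin n → Set where
  nil  : ∀ {v} → Walk E v v
  cons : ∀ {e w} → e ∈ E → Walk E (tgt e) w → Walk E (src e) w

len : ∀ {n} {E : List (Edge n)} {u v} → Walk E u v → ℚ
len nil = 0ℚ
len (cons {e = e} _ p) = wt e + len p

_++ʷ_ : ∀ {n} {E : List (Edge n)} {u v w} → Walk E u v → Walk E v w → Walk E u w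
nil ++ʷ q = q
cons m p ++ʷ q = cons m (p ++ʷ q)

data AllEdges {n : ℕ} {E : List (Edge n)} (P : Edge n → Set) : ∀ {u v} → Walk E u v → Set where
  nil  : ∀ {v} → AllEdges P (nil {v = v})
  cons : ∀ {e w} {m : e ∈ E} {p : Walk E (tgt e) w} → P e → AllEdges P p → AllEdges P (cons m p)

StronglyConnected : ∀ {n} → List (Edge n) → Set
StronglyConnected {n} E = (u v : Fin n) → Walk E u v

Shortest : ∀ {n} (E : List (Edge n)) {u v} → Walk E u v → Set
Shortest E {u} {v} p = (q : Walk E u v) → len p ≤ len q

IsDist : ∀ {n} (E : List (Edge n)) → Fin n → Fin n → ℚ → Set
IsDist E u v d = (Σ[ p ∈ Walk E u v ] len p ≡ d) × ((q : Walk E u v) → d ≤ len q)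

-- rank : total order on vertices (an injective map Fin n → Fin n).
Up : ∀ {n} → (Fin n → Fin n) → Edge n → Set
Up rank e = rank (src e) <ᶠ rank (tgt e)

Down : ∀ {n} → (Fin n → Fin n) → Edge n → Set
Down rank e = rank (tgt e) <ᶠ rank (src e)

data UpDown {n : ℕ} {E : List (Edge n)} (rank : Fin n → Fin n) : ∀ {u v} → Walk E u v → Set where
  down : ∀ {u v} {p : Walk E u v} → AllEdges (Down rank) p → UpDown rank p
  up   : ∀ {e w} {m : e ∈ E} {p : Walk E (tgt e) w} → Up rank e → UpDown rank p → UpDown rank (cons m p)

-- (rank, S) is a Contraction Hierarchy of G = E; H = E ++ S.
IsCH : ∀ {n} (E : List (Edge n)) (rank : Fin n → Fin n) (S : List (Edge n)) → Set
IsCH {n} E rank S =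
  Injective _≡_ _≡_ rank
  × All (λ e → Σ[ p ∈ Walk E (src e) (tgt e) ] len p ≡ wt e) S
  × ((s t : Fin n) → Walk E s t →
       Σ[ p ∈ Walk (E ++ S) s t ] (Shortest (E ++ S) p × UpDown rank p))

Transit : ∀ {n} → ℕ → (Fin n → Fin n) → Fin n → Set
Transit {n} k rank v = n ∸ k ≤ℕ toℕ (rank v)

-- Walks explored by the Dijkstra search from s in H↑ that never relaxes edges
-- leaving transit nodes: every edge is an upward edge of H whose source is not transit.
data SearchWalk {n : ℕ} (H : List (Edge n)) (rank : Fin n → Fin n) (T : Fin n → Set) : Fin n → Fin n → Set where
  nil  : ∀ {v} → SearchWalk H rank T v v
  cons : ∀ {e w} → e ∈ H → Up rank e → ¬ T (src e) → SearchWalk H rank T (tgt e) w → SearchWalk H rank T (src e) w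

slen : ∀ {n} {H : List (Edge n)} {rank T u v} → SearchWalk H rank T u v → ℚ
slen nil = 0ℚ
slen (cons {e = e} _ _ _ p) = wt e + slen p

Settled : ∀ {n} (H : List (Edge n)) (rank : Fin n → Fin n) (T : Fin n → Set) → Fin n → Fin n → ℚ → Set
Settled H rank T s v d =
  (Σ[ p ∈ SearchWalk H rank T s v ] slen p ≡ d) × ((q : SearchWalk H rank T s v) → d ≤ slen q)

InR : ∀ {n} (H : List (Edge n)) (rank : Fin n → Fin n) (T : Fin n → Set) → Fin n → Fin n → ℚ → Set
InR H rank T s t d = T t × Settled H rank T s t d

Stalled : ∀ {n} (H : List (Edge n)) (rank : Fin n → Fin n) (T : Fin n → Set)
          (D : Fin n → Fin n → ℚ) → Fin n → Fin n → ℚ → Set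
Stalled {n} H rank T D s t dt =
  Σ[ t₁ ∈ Fin n ] Σ[ d₁ ∈ ℚ ] (t₁ ≢ t × InR H rank T s t₁ d₁ × d₁ + D t₁ t ≤ dt)

FirstTransitOnShortest : ∀ {n} (E : List (Edge n)) (T : Fin n → Set) → Fin n → Fin n → Set
FirstTransitOnShortest {n} E T s t =
  Σ[ u ∈ Fin n ] Σ[ q ∈ Walk E s t ] Σ[ r ∈ Walk E t u ]
    (Shortest E (q ++ʷ r) × AllEdges (λ e → ¬ T (src e)) q)

-- Let P be a shortest s–t walk in G (it exists: expand the shortcuts of the CH
-- up-down path) and let t' be the first transit node on P, so P = q ++ r with q
-- avoiding transit nodes before t'.  If t' = t we are done.  Otherwise the CH gives
-- an up-down path to t' no longer than q; its prefix up to its first transit node x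
-- is a walk explored by the transit-limited upward search, followed by a G-walk
-- from x to t'.  Appending r, the search reaches x and then t along a walk of
-- positive length within δ(t) ≥ len P.  If x = t this contradicts the minimality
-- of δ(t); if x ≠ t, x is itself settled and D(x,t) is at most that remainder, so
-- t is stalled by x — contradicting the hypothesis.
module Submission where

open import Defs
open import Data.Nat using (ℕ)
open import Data.Fin using (Fin)
open import Data.Rational using (ℚ; 0ℚ; _<_)
open import Data.List using (List; _++_)
open import Data.List.Relation.Unary.All using (All)
open import Relation.Nullary using (¬_)

open import Data.Nat using (_∸_) renaming (_≤_ to _≤ℕ_; _≤?_ to _≤ℕ?_)
import Data.Nat.Properties as ℕ
open import Data.Fin using (toℕ; _>_) renaming (_<_ to _<ᶠ_)
import Data.Fin.Properties as Fin
open import Data.Fin.Induction using (>-wellFounded)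
open import Data.Rational using (_≤_; _+_)
open import Data.Rational.Properties
  using (≤-refl; ≤-trans; ≤-total; <⇒≤; <-irrefl; +-assoc; +-identityˡ; +-identityʳ;
         +-mono-≤; +-monoˡ-≤; +-monoʳ-≤; +-monoʳ-<; +-mono-<-≤; +-mono-≤-<; module ≤-Reasoning)
open import Data.List using ([]; _∷_)
open import Data.List.Membership.Propositional using (_∈_)
open import Data.List.Membership.Propositional.Properties using (∈-++⁺ˡ; ∈-++⁻)
import Data.List.Relation.Unary.All as All
open import Data.List.Relation.Unary.Any using (here; there)
open import Data.Product using (Σ-syntax; _×_; _,_; proj₁; proj₂)
open import Data.Sum using (_⊎_; inj₁; inj₂; [_,_]′)
open import Data.Empty using (⊥-elim)
open import Function using (_∘_; _on_)
open import Induction.WellFounded using (Acc; acc)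
import Relation.Binary.Construct.On as On
open import Relation.Nullary using (Dec; yes; no)
open import Relation.Binary.PropositionalEquality
  using (_≡_; _≢_; refl; sym; trans; cong; cong₂; subst; subst₂)

len-++ : ∀ {n} {E : List (Edge n)} {u v w} (p : Walk E u v) (q : Walk E v w) →
         len (p ++ʷ q) ≡ len p + len q
len-++ nil q = sym (+-identityˡ _)
len-++ (cons {e = e} m p) q =
  trans (cong (wt e +_) (len-++ p q)) (sym (+-assoc (wt e) (len p) (len q)))

len-nonneg : ∀ {n} {E : List (Edge n)} → All (λ e → 0ℚ < wt e) E →
             ∀ {u v} (p : Walk E u v) → 0ℚ ≤ len p
len-nonneg pos nil = ≤-refl
len-nonneg pos (cons {e = e} m p) =
  subst (_≤ wt e + len p) (+-identityˡ 0ℚ) (+-mono-≤ (<⇒≤ (All.lookup pos m)) (len-nonneg pos p))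

len-pos : ∀ {n} {E : List (Edge n)} → All (λ e → 0ℚ < wt e) E →
          ∀ {u v} (p : Walk E u v) → u ≢ v → 0ℚ < len p
len-pos pos nil u≢u = ⊥-elim (u≢u refl)
len-pos pos (cons {e = e} m p) _ =
  subst (_< wt e + len p) (+-identityˡ 0ℚ) (+-mono-<-≤ (All.lookup pos m) (len-nonneg pos p))

len-++-pos : ∀ {n} {E : List (Edge n)} → All (λ e → 0ℚ < wt e) E →
             ∀ {u v w} (p : Walk E u v) (q : Walk E v w) → 0ℚ < len q → 0ℚ < len (p ++ʷ q)
len-++-pos pos p q 0<q =
  subst (0ℚ <_) (sym (len-++ p q))
    (subst (_< len p + len q) (+-identityˡ 0ℚ) (+-mono-≤-< (len-nonneg pos p) 0<q))

<-+-pos : ∀ {x y} → 0ℚ < y → x < x + y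
<-+-pos {x} {y} 0<y = subst (_< x + y) (+-identityʳ x) (+-monoʳ-< x 0<y)

module Shortcuts {n} (E S : List (Edge n))
  (valid : All (λ e → Σ[ p ∈ Walk E (src e) (tgt e) ] len p ≡ wt e) S) where

  embed : ∀ {u v} → Walk E u v → Walk (E ++ S) u v
  embed nil = nil
  embed (cons m p) = cons (∈-++⁺ˡ m) (embed p)

  len-embed : ∀ {u v} (p : Walk E u v) → len (embed p) ≡ len p
  len-embed nil = refl
  len-embed (cons {e = e} m p) = cong (wt e +_) (len-embed p)

  expand : ∀ {u v} → Walk (E ++ S) u v → Walk E u v
  expand nil = nil
  expand (cons m p) with ∈-++⁻ E m
  ... | inj₁ m∈E = cons m∈E (expand p)
  ... | inj₂ m∈S = proj₁ (All.lookup valid m∈S) ++ʷ expand p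

  len-expand : ∀ {u v} (p : Walk (E ++ S) u v) → len (expand p) ≡ len p
  len-expand nil = refl
  len-expand (cons {e = e} m p) with ∈-++⁻ E m
  ... | inj₁ m∈E = cong (wt e +_) (len-expand p)
  ... | inj₂ m∈S = trans (len-++ (proj₁ (All.lookup valid m∈S)) (expand p))
                         (cong₂ _+_ (proj₂ (All.lookup valid m∈S)) (len-expand p))

toWalk : ∀ {n} {H : List (Edge n)} {rank T u v} → SearchWalk H rank T u v → Walk H u v
toWalk nil = nil
toWalk (cons m _ _ p) = cons m (toWalk p)

len-toWalk : ∀ {n} {H : List (Edge n)} {rank T u v} (p : SearchWalk H rank T u v) →
             len (toWalk p) ≡ slen p
len-toWalk nil = refl
len-toWalk (cons {e = e} m _ _ p) = cong (wt e +_) (len-toWalk p)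

-- Cheapest elements.  A type of candidates A with costs c is either empty or has
-- an element of least cost; the search walks to a node will be shown to be such.
HasMin : (A : Set) → (A → ℚ) → Set
HasMin A c = (Σ[ a ∈ A ] ∀ b → c a ≤ c b) ⊎ ¬ A

hasMin-transfer : ∀ {A B : Set} {c : A → ℚ} {d : B → ℚ} → HasMin A c →
  (f : A → B) → (∀ a → d (f a) ≡ c a) → (g : B → A) → (∀ b → c (g b) ≡ d b) →
  HasMin B d
hasMin-transfer (inj₁ (a , least)) f f-cost g g-cost =
  inj₁ (f a , λ b → subst₂ _≤_ (sym (f-cost a)) (g-cost b) (least (g b)))
hasMin-transfer (inj₂ ¬a) f f-cost g g-cost = inj₂ (¬a ∘ g)

hasMin-dec : ∀ {A : Set} {x : ℚ} → Dec A → HasMin A (λ _ → x)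
hasMin-dec (yes a) = inj₁ (a , λ _ → ≤-refl)
hasMin-dec (no ¬a) = inj₂ ¬a

hasMin-shift : ∀ {A : Set} {c : A → ℚ} (x : ℚ) → HasMin A c → HasMin A (λ a → x + c a)
hasMin-shift x (inj₁ (a , least)) = inj₁ (a , λ b → +-monoʳ-≤ x (least b))
hasMin-shift x (inj₂ ¬a) = inj₂ ¬a

hasMin-⊎ : ∀ {A B : Set} {c : A → ℚ} {d : B → ℚ} →
           HasMin A c → HasMin B d → HasMin (A ⊎ B) [ c , d ]′
hasMin-⊎ (inj₂ ¬a) (inj₂ ¬b) = inj₂ [ ¬a , ¬b ]′
hasMin-⊎ (inj₁ (a , least)) (inj₂ ¬b) =
  inj₁ (inj₁ a , λ { (inj₁ a′) → least a′ ; (inj₂ b) → ⊥-elim (¬b b) })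
hasMin-⊎ (inj₂ ¬a) (inj₁ (b , least)) =
  inj₁ (inj₂ b , λ { (inj₁ a) → ⊥-elim (¬a a) ; (inj₂ b′) → least b′ })
hasMin-⊎ {c = c} {d} (inj₁ (a , leastᴬ)) (inj₁ (b , leastᴮ)) with ≤-total (c a) (d b)
... | inj₁ a≤b = inj₁ (inj₁ a , λ { (inj₁ a′) → leastᴬ a′ ; (inj₂ b′) → ≤-trans a≤b (leastᴮ b′) })
... | inj₂ b≤a = inj₁ (inj₂ b , λ { (inj₁ a′) → ≤-trans b≤a (leastᴬ a′) ; (inj₂ b′) → leastᴮ b′ })

hasMin-Σ∈ : ∀ {X : Set} {A : X → Set} {c : ∀ x → A x → ℚ} (L : List X) →
            (∀ {x} → x ∈ L → HasMin (A x) (c x)) →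
            HasMin (Σ[ x ∈ X ] (x ∈ L × A x)) (λ (x , _ , a) → c x a)
hasMin-Σ∈ [] h = inj₂ λ ()
hasMin-Σ∈ {X = X} {A} (x ∷ L) h =
  hasMin-transfer (hasMin-⊎ (h (here refl)) (hasMin-Σ∈ L (h ∘ there)))
    cons-pos (λ { (inj₁ _) → refl ; (inj₂ _) → refl })
    uncons-pos (λ { (_ , here refl , _) → refl ; (_ , there _ , _) → refl })
  where
  cons-pos : A x ⊎ Σ[ y ∈ X ] (y ∈ L × A y) → Σ[ y ∈ X ] (y ∈ x ∷ L × A y)
  cons-pos (inj₁ a) = x , here refl , a
  cons-pos (inj₂ (y , m , a)) = y , there m , a

  uncons-pos : Σ[ y ∈ X ] (y ∈ x ∷ L × A y) → A x ⊎ Σ[ y ∈ X ] (y ∈ L × A y)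
  uncons-pos (_ , here refl , a) = inj₁ a
  uncons-pos (y , there m , a) = inj₂ (y , m , a)

-- The upward search from a node settles every node it reaches: the walks it
-- explores strictly increase in rank, so by well-founded induction on rank the
-- walks from x to v (empty, or a usable first edge followed by such a walk from
-- a higher-ranked node) always have a cheapest element when there are any.
module Search {n} (H : List (Edge n)) (rank : Fin n → Fin n)
  {T : Fin n → Set} (T? : ∀ v → Dec (T v)) where

  SW : Fin n → Fin n → Set
  SW = SearchWalk H rank T

  Step : Fin n → Fin n → Edge n → Set
  Step x v e = src e ≡ x × Up rank e × ¬ T (src e) × SW (tgt e) v

  stepCost : ∀ {x v} e → Step x v e → ℚ
  stepCost e (_ , _ , _ , w) = wt e + slen w

  Shape : Fin n → Fin n → Set
  Shape x v = x ≡ v ⊎ Σ[ e ∈ Edge n ] (e ∈ H × Step x v e)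

  shapeCost : ∀ {x v} → Shape x v → ℚ
  shapeCost = [ (λ _ → 0ℚ) , (λ (e , _ , st) → stepCost e st) ]′

  fromShape : ∀ {x v} → Shape x v → SW x v
  fromShape (inj₁ refl) = nil
  fromShape (inj₂ (e , m , refl , ↑ , ¬T , w)) = cons m ↑ ¬T w

  toShape : ∀ {x v} → SW x v → Shape x v
  toShape nil = inj₁ refl
  toShape (cons {e = e} m ↑ ¬T w) = inj₂ (e , m , refl , ↑ , ¬T , w)

  slen-fromShape : ∀ {x v} (sh : Shape x v) → slen (fromShape sh) ≡ shapeCost sh
  slen-fromShape (inj₁ refl) = refl
  slen-fromShape (inj₂ (e , m , refl , ↑ , ¬T , w)) = refl

  shapeCost-toShape : ∀ {x v} (w : SW x v) → shapeCost (toShape w) ≡ slen w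
  shapeCost-toShape nil = refl
  shapeCost-toShape (cons m ↑ ¬T w) = refl

  cheapestWalk : ∀ x v → Acc (_>_ on rank) x → HasMin (SW x v) slen
  cheapestWalk x v (acc higher) =
    hasMin-transfer (hasMin-⊎ (hasMin-dec (x Fin.≟ v)) (hasMin-Σ∈ H cheapestStep))
      fromShape slen-fromShape toShape shapeCost-toShape
    where
    cheapestStep : ∀ {e} → e ∈ H → HasMin (Step x v e) (stepCost e)
    cheapestStep {e} _ with src e Fin.≟ x | rank (src e) Fin.<? rank (tgt e) | T? (src e)
    ... | no src≢x | _ | _ = inj₂ (src≢x ∘ proj₁)
    ... | yes _ | no ¬up | _ = inj₂ (¬up ∘ proj₁ ∘ proj₂)
    ... | yes _ | yes _ | yes Tsrc = inj₂ (λ (_ , _ , ¬T , _) → ¬T Tsrc)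
    ... | yes src≡x | yes ↑ | no ¬T =
      hasMin-transfer
        (hasMin-shift (wt e) (cheapestWalk (tgt e) v
          (higher (subst (λ y → rank y <ᶠ rank (tgt e)) src≡x ↑))))
        (λ w → src≡x , ↑ , ¬T , w) (λ _ → refl) (proj₂ ∘ proj₂ ∘ proj₂) (λ _ → refl)

  settled : ∀ {s v} (q : SW s v) → Σ[ d ∈ ℚ ] (Settled H rank T s v d × d ≤ slen q)
  settled {s} {v} q with cheapestWalk s v (On.wellFounded rank >-wellFounded s)
  ... | inj₁ (p , least) = slen p , ((p , refl) , least) , least q
  ... | inj₂ none = ⊥-elim (none q)

splitFirst : ∀ {n} {E : List (Edge n)} {T : Fin n → Set} → (∀ v → Dec (T v)) →
  ∀ {u v} → T v → (p : Walk E u v) →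
  Σ[ t ∈ Fin n ] Σ[ q ∈ Walk E u t ] Σ[ r ∈ Walk E t v ]
    (q ++ʷ r ≡ p × AllEdges (λ e → ¬ T (src e)) q × T t)
splitFirst T? Tv nil = _ , nil , nil , refl , nil , Tv
splitFirst T? Tv (cons {e = e} m p) with T? (src e)
... | yes Tsrc = src e , nil , cons m p , refl , nil , Tsrc
... | no ¬Tsrc with splitFirst T? Tv p
...   | t , q , r , q++r≡p , q-avoids , Tt =
        t , cons m q , r , cong (cons m) q++r≡p , cons ¬Tsrc q-avoids , Tt

down-rank : ∀ {n} {H : List (Edge n)} {rank : Fin n → Fin n} {u v} {p : Walk H u v} →
            AllEdges (Down rank) p → toℕ (rank v) ≤ℕ toℕ (rank u)
down-rank nil = ℕ.≤-refl
down-rank (cons down-e rest) = ℕ.≤-trans (down-rank rest) (ℕ.<⇒≤ down-e)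

-- For a set T closed upwards in rank, an up-down walk into T splits into a walk
-- of the T-limited upward search, ending at its first node in T, and the rest:
-- a downward part cannot enter T from outside it.
splitUpDown : ∀ {n} {H : List (Edge n)} (rank : Fin n → Fin n) {T : Fin n → Set} →
  (∀ v → Dec (T v)) → (∀ {u v} → toℕ (rank u) ≤ℕ toℕ (rank v) → T u → T v) →
  ∀ {u v} → T v → (p : Walk H u v) → UpDown rank p →
  Σ[ x ∈ Fin n ] Σ[ a ∈ SearchWalk H rank T u x ] Σ[ b ∈ Walk H x v ]
    (T x × len p ≡ slen a + len b)
splitUpDown rank T? T-up {u} Tv p p-ud with T? u
... | yes Tu = u , nil , p , Tu , sym (+-identityˡ _)
splitUpDown rank T? T-up Tv p (down p-down) | no ¬Tu = ⊥-elim (¬Tu (T-up (down-rank p-down) Tv))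
splitUpDown rank T? T-up Tv (cons {e = e} m p) (up ↑ p-ud) | no ¬Tu
  with splitUpDown rank T? T-up Tv p p-ud
... | x , a , b , Tx , p≡a+b =
  x , cons m ↑ ¬Tu a , b , Tx ,
  trans (cong (wt e +_) p≡a+b) (sym (+-assoc (wt e) (slen a) (len b)))

module ContractionHierarchy {n} (E : List (Edge n)) (rank : Fin n → Fin n) (S : List (Edge n))
  (isCH : IsCH E rank S) where

  H : List (Edge n)
  H = E ++ S

  open Shortcuts E S (proj₁ (proj₂ isCH)) public

  chPath : ∀ {s t} → Walk E s t → Walk H s t
  chPath {s} {t} q = proj₁ (proj₂ (proj₂ isCH) s t q)

  chPath-upDown : ∀ {s t} (q : Walk E s t) → UpDown rank (chPath q)
  chPath-upDown {s} {t} q = proj₂ (proj₂ (proj₂ (proj₂ isCH) s t q))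

  -- The CH path is a shortest walk of H, hence no longer than any walk of G.
  chPath-≤ : ∀ {s t} (q q′ : Walk E s t) → len (chPath q) ≤ len q′
  chPath-≤ {s} {t} q q′ =
    subst (len (chPath q) ≤_) (len-embed q′) (proj₁ (proj₂ (proj₂ (proj₂ isCH) s t q)) (embed q′))

  shortestWalk : ∀ {s t} → Walk E s t → Σ[ p ∈ Walk E s t ] Shortest E p
  shortestWalk q =
    expand (chPath q) , λ q′ → subst (_≤ len q′) (sym (len-expand (chPath q))) (chPath-≤ q q′)

  shortest≤search : ∀ {s t} {T : Fin n → Set} {p : Walk E s t} → Shortest E p →
                    (w : SearchWalk H rank T s t) → len p ≤ slen w
  shortest≤search p-shortest w =
    subst (_ ≤_) (trans (len-expand (toWalk w)) (len-toWalk w)) (p-shortest (expand (toWalk w)))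

  searchThenWalk : {T : Fin n → Set} → (∀ v → Dec (T v)) →
    (∀ {u v} → toℕ (rank u) ≤ℕ toℕ (rank v) → T u → T v) →
    ∀ {s t} → T t → (q : Walk E s t) →
    Σ[ x ∈ Fin n ] Σ[ a ∈ SearchWalk H rank T s x ] Σ[ b ∈ Walk E x t ]
      (T x × slen a + len b ≤ len q)
  searchThenWalk T? T-up Tt q
    with splitUpDown rank T? T-up Tt (chPath q) (chPath-upDown q)
  ... | x , a , b , Tx , p≡a+b =
    x , a , expand b , Tx ,
    subst (_≤ len q) (trans p≡a+b (cong (slen a +_) (sym (len-expand b)))) (chPath-≤ q q)

module PostSearchStalling {n} (E : List (Edge n)) (pos : All (λ e → 0ℚ < wt e) E)
  (rank : Fin n → Fin n) (S : List (Edge n)) (isCH : IsCH E rank S)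
  (k : ℕ) (D : Fin n → Fin n → ℚ)
  (dist : ∀ a b → Transit k rank a → Transit k rank b → IsDist E a b (D a b)) where

  T : Fin n → Set
  T = Transit k rank

  T? : ∀ v → Dec (T v)
  T? v = (n ∸ k) ≤ℕ? toℕ (rank v)

  T-up : ∀ {u v} → toℕ (rank u) ≤ℕ toℕ (rank v) → T u → T v
  T-up u≤v Tu = ℕ.≤-trans Tu u≤v

  open ContractionHierarchy E rank S isCH public
  open Search H rank T? using (settled)

  -- If the search reaches a transit node x and a G-walk of positive length leads
  -- from x to t ∈ R(s) within δ(t), then x stalls t; x = t is impossible since
  -- δ(t) is the least search distance to t.
  stalledVia : ∀ {s t x δt} → InR H rank T s t δt →
    (a : SearchWalk H rank T s x) → T x → (w : Walk E x t) → 0ℚ < len w →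
    slen a + len w ≤ δt → Stalled H rank T D s t δt
  stalledVia {t = t} {x} {δt} (Tt , _ , δt-least) a Tx w w-pos a+w≤δt with x Fin.≟ t
  ... | yes refl = ⊥-elim (<-irrefl refl (begin-strict
          δt             ≤⟨ δt-least a ⟩
          slen a         <⟨ <-+-pos w-pos ⟩
          slen a + len w ≤⟨ a+w≤δt ⟩
          δt             ∎))
    where open ≤-Reasoning
  ... | no x≢t with settled a
  ...   | d , x-settled , d≤a = x , d , x≢t , (Tx , x-settled) , (begin
          d + D x t      ≤⟨ +-mono-≤ d≤a (proj₂ (dist x t Tx Tt) w) ⟩
          slen a + len w ≤⟨ a+w≤δt ⟩
          δt             ∎)
    where open ≤-Reasoning

  bypass⇒stalled : ∀ {s t t' δt} → InR H rank T s t δt → T t' → t' ≢ t →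
    (q : Walk E s t') (r : Walk E t' t) → len (q ++ʷ r) ≤ δt → Stalled H rank T D s t δt
  bypass⇒stalled {δt = δt} inR Tt' t'≢t q r q+r≤δt with searchThenWalk T? T-up Tt' q
  ... | x , a , b , Tx , a+b≤q =
    stalledVia inR a Tx (b ++ʷ r) (len-++-pos pos b r (len-pos pos r t'≢t)) (begin
      slen a + len (b ++ʷ r)   ≡⟨ cong (slen a +_) (len-++ b r) ⟩
      slen a + (len b + len r) ≡⟨ sym (+-assoc (slen a) (len b) (len r)) ⟩
      slen a + len b + len r   ≤⟨ +-monoˡ-≤ (len r) a+b≤q ⟩
      len q + len r            ≡⟨ sym (len-++ q r) ⟩
      len (q ++ʷ r)            ≤⟨ q+r≤δt ⟩
      δt                       ∎)
    where open ≤-Reasoning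

lemma2 : ∀ {n} (E : List (Edge n)) → All (λ e → 0ℚ < wt e) E → StronglyConnected E →
    (rank : Fin n → Fin n) (S : List (Edge n)) → IsCH E rank S →
    (k : ℕ) (D : Fin n → Fin n → ℚ) →
    (∀ a b → Transit k rank a → Transit k rank b → IsDist E a b (D a b)) →
    (s t : Fin n) (δt : ℚ) →
    InR (E ++ S) rank (Transit k rank) s t δt →
    ¬ Stalled (E ++ S) rank (Transit k rank) D s t δt →
    FirstTransitOnShortest E (Transit k rank) s t
lemma2 E pos sc rank S isCH k D dist s t δt inR not-stalled = firstTransit
  where
  open PostSearchStalling E pos rank S isCH k D dist

  P : Walk E s t
  P = proj₁ (shortestWalk (sc s t))

  P-shortest : Shortest E P
  P-shortest = proj₂ (shortestWalk (sc s t))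

  P≤δt : len P ≤ δt
  P≤δt = let (Tt , (w , w≡δt) , _) = inR in
         subst (len P ≤_) w≡δt (shortest≤search {p = P} P-shortest w)

  firstTransit : FirstTransitOnShortest E T s t
  firstTransit with splitFirst T? (proj₁ inR) P
  ... | t' , q , r , q++r≡P , q-avoids , Tt' with t' Fin.≟ t
  ...   | yes refl = t , q , r , subst (Shortest E) (sym q++r≡P) P-shortest , q-avoids
  ...   | no t'≢t = ⊥-elim (not-stalled (bypass⇒stalled inR Tt' t'≢t q r
                      (subst (_≤ δt) (sym (cong len q++r≡P)) P≤δt)))
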